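{- Let $r\ge1$, $s\ge3$. The extremal rays of $\mathsf{EqLR}_r^s$ lying on every Horn facet (where, when $r=1$, the inequality $\sum_j|\lambda^j|\ge|\nu|$ is regarded as the Horn inequality) are exactly the rays $\mathbb{R}_{\ge0}x_j$, $j\in[s-1]$, where $x_j=(0,\dots,0,\omega_r,0,\dots,0,\omega_r)$ has $\omega_r=(1,\dots,1)$ in the $j$-th block and in the last ($s$-th) block and $0$ elsewhere.
   Context: Points of $\mathbb{R}^{rs}$ are written $(\lambda^1,\dots,\lambda^{s-1},\nu)$ with $\lambda^j,\nu\in\mathbb{R}^r$; $|\lambda|=\sum_i\lambda_i$; $\lambda\subseteq\mu$ means $\lambda_i\le\mu_i$ for all $i$. $\tau(\{i_1<\dots<i_e\})=(i_e-e\ge\dots\ge i_1-1)$; $c^{L}_{J_1,\dots,J_{s-1}}$ (for $e$-element sets) is the coefficient of $[X_{\tau(L)}]$ in $[X_{\tau(J_1)}]\cdots[X_{\tau(J_{s-1})}]$ in $H^*(\mathrm{Gr}(e,\mathbb{C}^n))$, $n$ large. Horn inequalities (for $r\ge2$): for every $1\le e<r$ and $e$-subsets $J_1,\dots,J_{s-1},L\subseteq[r]$ with $c^L_{J_1,\dots,J_{s-1}}=1$, the inequality $\sum_j\sum_{a\in J_j}\lambda^j_a\ge\sum_{k\in L}\nu_k$. $\mathsf{EqLR}_r^s$ is the set of points with: each $\lambda^j,\nu$ weakly decreasing; $\lambda^j_r\ge0$ for all $j$; $\lambda^j\subseteq\nu$ for all $j$; $\sum_j|\lambda^j|\ge|\nu|$;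 and all Horn inequalities. A Horn facet is the subset of $\mathsf{EqLR}_r^s$ where a given Horn inequality holds with equality.
   Formalization: Points are taken in ℚ^(rs) rather than $\mathbb{R}^{rs}$, so the cone $\mathsf{EqLR}_r^s$, the decompositions testing extremality and the scalars spanning the rays are rational. -}

module Defs where

open import Data.Bool using (Bool; true; false; _∧_; if_then_else_)
open import Data.Nat as ℕ using (ℕ; zero; suc; _∸_; _<ᵇ_; _≡ᵇ_; _≤ᵇ_)
open import Data.Integer as ℤ using (ℤ)
open import Data.Rational as ℚ using (ℚ; 0ℚ)
open import Data.Fin using (Fin; toℕ)
import Data.Fin
import Data.Bool
open import Data.Fin.Subset using (Subset)
open import Data.Fin.Subset.Properties using (_∈?_)
open import Data.List using (List; []; _∷_; [_]; map; concatMap; filter; zipWith; replicate; upTo; downFrom; reverse; concat; foldr; allFin; length)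
open import Data.List.Properties using (≡-dec)
open import Data.Product using (_×_; _,_; proj₁; proj₂; Σ; ∃)
open import Relation.Nullary using (does)
open import Relation.Binary.PropositionalEquality using (_≡_)

sumFin : ∀ {n} → (Fin n → ℚ) → ℚ
sumFin {zero}  f = 0ℚ
sumFin {suc n} f = f Data.Fin.zero ℚ.+ sumFin (λ i → f (Data.Fin.suc i))


-- Polynomials in e variables with integer coefficients, as lists of
-- terms (coefficient , exponent vector); exponent vectors are lists of
-- length e, entry a being the exponent of x_{a+1}.

Mono : Set
Mono = List ℕ

Poly : Set
Poly = List (ℤ × Mono)

onePoly : ℕ → Poly
onePoly e = [ (ℤ.+ 1 , replicate e 0) ]

_*ᴾ_ : Poly → Poly → Poly
p *ᴾ q = concatMap (λ t → map (λ u → (proj₁ t ℤ.* proj₁ u , zipWith ℕ._+_ (proj₂ t) (proj₂ u))) q) p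

coeff : Mono → Poly → ℤ
coeff m p = foldr (λ t acc → (if does (≡-dec ℕ._≟_ (proj₂ t) m) then proj₁ t else ℤ.+ 0) ℤ.+ acc) (ℤ.+ 0) p

unitMono : ℕ → ℕ → Mono
unitMono e a = map (λ i → if i ≡ᵇ a then 1 else 0) (upTo e)

vandermonde : ℕ → Poly
vandermonde e =
  foldr _*ᴾ_ (onePoly e)
    (concatMap (λ a → map (λ b → (ℤ.+ 1 , unitMono e a) ∷ (ℤ.- (ℤ.+ 1) , unitMono e b) ∷ [])
                           (filter (λ b → a ℕ.<? b) (upTo e)))
               (upTo e))

wincr : ℕ → ℕ → ℕ → List (List ℕ)
wincr e zero    lo = [ [] ]
wincr e (suc ℓ) lo = concatMap (λ v → map (v ∷_) (wincr e ℓ v)) (filter (λ v → lo ℕ.≤? v) (upTo e))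

rowFillings : ℕ → List ℕ → List (List (List ℕ))
rowFillings e []      = [ [] ]
rowFillings e (m ∷ μ) = concatMap (λ row → map (row ∷_) (rowFillings e μ)) (wincr e m 0)

colStrict : List (List ℕ) → Bool
colStrict (u ∷ w ∷ rest) = foldr _∧_ true (zipWith _<ᵇ_ u w) ∧ colStrict (w ∷ rest)
colStrict _              = true

tabMono : ℕ → List (List ℕ) → Mono
tabMono e T = map (λ a → length (filter (λ v → v ℕ.≟ a) (concat T))) (upTo e)

schur : ℕ → List ℕ → Poly
schur e μ = map (λ T → (ℤ.+ 1 , tabMono e T)) (filter (λ T → Data.Bool._≟_ (colStrict T) true) (rowFillings e μ))
  where import Data.Bool

-- Coefficient of s_ν in s_{μ_1} ⋯ s_{μ_k} in e variables:
-- the coefficient of x^{ν+δ} in a_δ · s_{μ_1} ⋯ s_{μ_k}, δ = (e-1,…,1,0).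
-- For n large this is the coefficient of [X_ν] in [X_{μ_1}]⋯[X_{μ_k}]
-- in H^*(Gr(e,ℂ^n)).
lrCoeff : ℕ → List (List ℕ) → List ℕ → ℤ
lrCoeff e μs ν = coeff (zipWith ℕ._+_ ν (downFrom e)) (vandermonde e *ᴾ foldr (λ μ acc → schur e μ *ᴾ acc) (onePoly e) μs)

members : ∀ {r} → Subset r → List ℕ
members {r} p = map (λ i → suc (toℕ i)) (filter (λ i → i ∈? p) (allFin r))

τ : ∀ {r} → Subset r → List ℕ
τ p = reverse (zipWith _∸_ (members p) (map suc (upTo (length (members p)))))

cLR : ∀ {r k} → ℕ → (Fin k → Subset r) → Subset r → ℤ
cLR {k = k} e J L = lrCoeff e (map (λ j → τ (J j)) (allFin k)) (τ L)

record Pt (r s : ℕ) : Set where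
  constructor pt
  field
    lam : Fin (s ∸ 1) → Fin r → ℚ
    nu  : Fin r → ℚ

open Pt public

∣_∣ᵥ : ∀ {r} → (Fin r → ℚ) → ℚ
∣ v ∣ᵥ = sumFin v

subsetSum : ∀ {r} → Subset r → (Fin r → ℚ) → ℚ
subsetSum p v = sumFin (λ i → if does (i ∈? p) then v i else 0ℚ)

WeaklyDecr : ∀ {r} → (Fin r → ℚ) → Set
WeaklyDecr v = ∀ i j → toℕ i ℕ.≤ toℕ j → v j ℚ.≤ v i

_⊆ᵥ_ : ∀ {r} → (Fin r → ℚ) → (Fin r → ℚ) → Set
u ⊆ᵥ v = ∀ i → u i ℚ.≤ v i

record HornData (r s : ℕ) : Set where
  field
    e     : ℕ
    e≥1   : 1 ℕ.≤ e
    e<r   : e ℕ.< r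
    J     : Fin (s ∸ 1) → Subset r
    L     : Subset r
    J-card : ∀ j → Data.Fin.Subset.∣ J j ∣ ≡ e
    L-card : Data.Fin.Subset.∣ L ∣ ≡ e
    c≡1   : cLR e J L ≡ ℤ.+ 1

hornLHS : ∀ {r s} → HornData r s → Pt r s → ℚ
hornLHS h x = sumFin (λ j → subsetSum (HornData.J h j) (lam x j))

hornRHS : ∀ {r s} → HornData r s → Pt r s → ℚ
hornRHS h x = subsetSum (HornData.L h) (nu x)

EqLR : (r s : ℕ) → Pt r s → Set
EqLR r s x =
    (∀ j → WeaklyDecr (lam x j))
  × WeaklyDecr (nu x)
  × (∀ j (i : Fin r) → toℕ i ≡ r ∸ 1 → 0ℚ ℚ.≤ lam x j i)
  × (∀ j → lam x j ⊆ᵥ nu x)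
  × (∣ nu x ∣ᵥ ℚ.≤ sumFin (λ j → ∣ lam x j ∣ᵥ))
  × (∀ (h : HornData r s) → hornRHS h x ℚ.≤ hornLHS h x)

OnAllHornFacets : (r s : ℕ) → Pt r s → Set
OnAllHornFacets r s x =
    (r ≡ 1 → sumFin (λ j → ∣ lam x j ∣ᵥ) ≡ ∣ nu x ∣ᵥ)
  × (∀ (h : HornData r s) → hornLHS h x ≡ hornRHS h x)

_≈ₚ_ : ∀ {r s} → Pt r s → Pt r s → Set
x ≈ₚ y = (∀ j i → lam x j i ≡ lam y j i) × (∀ i → nu x i ≡ nu y i)

_+ₚ_ : ∀ {r s} → Pt r s → Pt r s → Pt r s
x +ₚ y = pt (λ j i → lam x j i ℚ.+ lam y j i) (λ i → nu x i ℚ.+ nu y i)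

_·ₚ_ : ∀ {r s} → ℚ → Pt r s → Pt r s
c ·ₚ x = pt (λ j i → c ℚ.* lam x j i) (λ i → c ℚ.* nu x i)

zeroₚ : ∀ {r s} → Pt r s
zeroₚ = pt (λ j i → 0ℚ) (λ i → 0ℚ)

IsExtremalRay : ∀ {r s} → (Pt r s → Set) → Pt r s → Set
IsExtremalRay {r} {s} C x =
    C x
  × ¬ (x ≈ₚ zeroₚ)
  × (∀ (y z : Pt r s) → C y → C z → (y +ₚ z) ≈ₚ x →
       Σ ℚ (λ c → (0ℚ ℚ.≤ c) × (y ≈ₚ (c ·ₚ x))))
  where open import Relation.Nullary using (¬_)

xRay : ∀ {r s} → Fin (s ∸ 1) → Pt r s
xRay j = pt (λ j' i → if does (j Data.Fin.≟ j') then ℚ.1ℚ else 0ℚ) (λ i → ℚ.1ℚ)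
  where import Data.Fin

{-# OPTIONS --safe #-}
-- For e = 1 the Horn inequalities with J_j = {a}, J_{j'} = {1} (j' ≠ j) and L = {a} have c = 1,
-- so on all Horn facets ν_a = λ^j_a + Σ_{j'≠j} λ^{j'}_1 for every block j and row a.  Using these
-- equations for two different blocks (here s ≥ 3 enters) gives Σ_j λ^j_a ≤ 2ν_a − ν_1 ≤ ν_a, and
-- |ν| ≤ Σ_j |λ^j| forces equality everywhere: ν and every λ^j are constant, i.e. x = Σ_j λ^j_1 x_j.
-- Such a nonnegative combination of the x_j is extremal only if a single coefficient survives.
-- Conversely, if y + z = c x_j with y, z ∈ EqLR, then the monotonicity, containment and
-- nonnegativity conditions squeeze y, entry by entry, onto a multiple of x_j.
module Submission where

open import Defs
open import Data.Bool using (Bool; true; false; if_then_else_)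
open import Data.Bool.Properties using (if-eta)
open import Data.Empty using (⊥-elim)
open import Data.Fin using (Fin; zero; suc; toℕ; fromℕ; _≟_)
open import Data.Fin.Properties using (any?; toℕ≤pred[n]; toℕ-fromℕ)
open import Data.Vec using ([]; _∷_)
open import Data.Fin.Subset as Subset using (Subset; inside; outside; ⁅_⁆)
open import Data.Fin.Subset.Properties using (_∈?_; ∣⁅x⁆∣≡1)
open import Data.Integer as ℤ using ()
open import Data.List using (List; []; _∷_; [_]; _++_; length; foldr; map; filter; tabulate; replicate; allFin)
open import Data.List.Properties using (map-tabulate; tabulate-cong; ≡-dec)
open import Data.Nat as ℕ using (ℕ; _∸_; z≤n; s≤s)
import Data.Nat
open import Data.Nat.ListAction using (sum)
import Data.Nat.Properties as ℕ
open import Data.Product using (Σ; _×_; _,_; proj₁; proj₂)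
open import Data.Rational as ℚ using (ℚ; 0ℚ; 1ℚ; _+_; _*_; _<_; 1/_; Positive)
open import Data.Rational.Properties as ℚ using ()
open import Data.Rational.Solver using (module +-*-Solver)
open import Function using (_∘_)
open import Function.Bundles using (_⇔_; mk⇔)
open import Relation.Nullary using (¬_; does; yes; no)
open import Relation.Nullary.Decidable using (dec-true)
open import Relation.Binary.PropositionalEquality hiding ([_]; J)

open +-*-Solver using (solve; _:+_; _:*_; _:=_)

-- The development uses the order of ℚ; it is kept in an anonymous module so that the order
-- of ℕ can be opened for the final statement.
module _ where

  open import Data.Rational using (_≤_)

  +-cancelʳ-≤ : ∀ {p q} r → p + r ≤ q + r → p ≤ q
  +-cancelʳ-≤ r p+r≤q+r =
    ℚ.≮⇒≥ (λ q<p → ℚ.<-irrefl refl (ℚ.<-≤-trans (ℚ.+-monoˡ-< r q<p) p+r≤q+r))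

  +-cancelˡ-≤ : ∀ r {p q} → r + p ≤ r + q → p ≤ q
  +-cancelˡ-≤ r {p} {q} r+p≤r+q =
    +-cancelʳ-≤ r (subst₂ _≤_ (ℚ.+-comm r p) (ℚ.+-comm r q) r+p≤r+q)

  ≤-+-≡⇒≡ˡ : ∀ {p q r t} → p ≤ q → r ≤ t → p + r ≡ q + t → p ≡ q
  ≤-+-≡⇒≡ˡ p≤q r≤t eq =
    ℚ.≤-antisym p≤q (ℚ.≮⇒≥ (λ p<q → ℚ.<-irrefl eq (ℚ.+-mono-<-≤ p<q r≤t)))

  ≤-+-≡⇒≡ʳ : ∀ {p q r t} → p ≤ q → r ≤ t → p + r ≡ q + t → r ≡ t
  ≤-+-≡⇒≡ʳ {p} {q} {r} {t} p≤q r≤t eq =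
    ≤-+-≡⇒≡ˡ r≤t p≤q (trans (ℚ.+-comm r p) (trans eq (ℚ.+-comm q t)))

  *-cancelʳ-≡-pos : ∀ {p q} r .{{_ : Positive r}} → p * r ≡ q * r → p ≡ q
  *-cancelʳ-≡-pos r eq =
    ℚ.≤-antisym (ℚ.*-cancelʳ-≤-pos r (ℚ.≤-reflexive eq)) (ℚ.*-cancelʳ-≤-pos r (ℚ.≤-reflexive (sym eq)))

  sumFin-cong : ∀ {n} {f g : Fin n → ℚ} → (∀ i → f i ≡ g i) → sumFin f ≡ sumFin g
  sumFin-cong {ℕ.zero}  f≡g = refl
  sumFin-cong {ℕ.suc n} f≡g = cong₂ _+_ (f≡g zero) (sumFin-cong (f≡g ∘ suc))

  sumFin-zero : ∀ n → sumFin {n} (λ _ → 0ℚ) ≡ 0ℚ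
  sumFin-zero ℕ.zero    = refl
  sumFin-zero (ℕ.suc n) = trans (ℚ.+-identityˡ _) (sumFin-zero n)

  sumFin-+ : ∀ {n} (f g : Fin n → ℚ) → sumFin (λ i → f i + g i) ≡ sumFin f + sumFin g
  sumFin-+ {ℕ.zero}  f g = refl
  sumFin-+ {ℕ.suc n} f g = begin
    (f zero + g zero) + sumFin (λ i → f (suc i) + g (suc i))
      ≡⟨ cong ((f zero + g zero) +_) (sumFin-+ (f ∘ suc) (g ∘ suc)) ⟩
    (f zero + g zero) + (sumFin (f ∘ suc) + sumFin (g ∘ suc))
      ≡⟨ solve 4 (λ a b c d → (a :+ b) :+ (c :+ d) := (a :+ c) :+ (b :+ d)) refl
           (f zero) (g zero) (sumFin (f ∘ suc)) (sumFin (g ∘ suc)) ⟩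
    (f zero + sumFin (f ∘ suc)) + (g zero + sumFin (g ∘ suc)) ∎
    where open ≡-Reasoning

  sumFin-swap : ∀ {m n} (g : Fin m → Fin n → ℚ) →
    sumFin (λ j → sumFin (g j)) ≡ sumFin (λ i → sumFin (λ j → g j i))
  sumFin-swap {ℕ.zero}  {n} g = sym (sumFin-zero n)
  sumFin-swap {ℕ.suc m} {n} g =
    trans (cong (sumFin (g zero) +_) (sumFin-swap (g ∘ suc)))
          (sym (sumFin-+ (g zero) (λ i → sumFin (λ j → g (suc j) i))))

  sumFin-mono : ∀ {n} {f g : Fin n → ℚ} → (∀ i → f i ≤ g i) → sumFin f ≤ sumFin g
  sumFin-mono {ℕ.zero}  f≤g = ℚ.≤-refl
  sumFin-mono {ℕ.suc n} f≤g = ℚ.+-mono-≤ (f≤g zero) (sumFin-mono (f≤g ∘ suc))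

  sumFin-mono-≡⇒≡ : ∀ {n} {f g : Fin n → ℚ} → (∀ i → f i ≤ g i) → sumFin f ≡ sumFin g → ∀ i → f i ≡ g i
  sumFin-mono-≡⇒≡ {ℕ.suc n} f≤g eq zero    = ≤-+-≡⇒≡ˡ (f≤g zero) (sumFin-mono (f≤g ∘ suc)) eq
  sumFin-mono-≡⇒≡ {ℕ.suc n} f≤g eq (suc i) =
    sumFin-mono-≡⇒≡ (f≤g ∘ suc) (≤-+-≡⇒≡ʳ (f≤g zero) (sumFin-mono (f≤g ∘ suc)) eq) i

  sumFin-mono-≥⇒≡ : ∀ {n} {f g : Fin n → ℚ} → (∀ i → f i ≤ g i) → sumFin g ≤ sumFin f → ∀ i → f i ≡ g i
  sumFin-mono-≥⇒≡ f≤g Σg≤Σf = sumFin-mono-≡⇒≡ f≤g (ℚ.≤-antisym (sumFin-mono f≤g) Σg≤Σf)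

  sumFin-nonneg : ∀ {n} {f : Fin n → ℚ} → (∀ i → 0ℚ ≤ f i) → 0ℚ ≤ sumFin f
  sumFin-nonneg {n} {f} f≥0 = subst (_≤ sumFin f) (sumFin-zero n) (sumFin-mono f≥0)

  ≤-sumFin : ∀ {n} {f : Fin n → ℚ} → (∀ i → 0ℚ ≤ f i) → ∀ j → f j ≤ sumFin f
  ≤-sumFin {ℕ.suc n} {f} f≥0 zero    =
    subst (_≤ sumFin f) (ℚ.+-identityʳ (f zero)) (ℚ.+-monoʳ-≤ (f zero) (sumFin-nonneg (f≥0 ∘ suc)))
  ≤-sumFin {ℕ.suc n} {f} f≥0 (suc j) =
    subst (_≤ sumFin f) (ℚ.+-identityˡ (f (suc j))) (ℚ.+-mono-≤ (f≥0 zero) (≤-sumFin (f≥0 ∘ suc) j))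

  δ : ∀ {k} → Fin k → Fin k → ℚ
  δ j j′ = if does (j ≟ j′) then 1ℚ else 0ℚ

  δ-diag : ∀ {k} (j : Fin k) → δ j j ≡ 1ℚ
  δ-diag j rewrite dec-true (j ≟ j) refl = refl

  sumFin-*δ : ∀ {k} (c : ℚ) (j : Fin k) → sumFin (λ j′ → c * δ j j′) ≡ c
  sumFin-*δ {ℕ.suc k} c zero    = begin
    c * 1ℚ + sumFin {k} (λ _ → c * 0ℚ) ≡⟨ cong₂ _+_ (ℚ.*-identityʳ c) (sumFin-cong {k} (λ _ → ℚ.*-zeroʳ c)) ⟩
    c + sumFin {k} (λ _ → 0ℚ)          ≡⟨ cong (c +_) (sumFin-zero k) ⟩
    c + 0ℚ                              ≡⟨ ℚ.+-identityʳ c ⟩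
    c ∎
    where open ≡-Reasoning
  sumFin-*δ {ℕ.suc k} c (suc j) =
    trans (cong (_+ sumFin (λ j′ → c * δ j j′)) (ℚ.*-zeroʳ c)) (trans (ℚ.+-identityˡ _) (sumFin-*δ c j))

  subsetSum-cong : ∀ {n} (p : Subset n) {v w : Fin n → ℚ} → (∀ i → v i ≡ w i) → subsetSum p v ≡ subsetSum p w
  subsetSum-cong p v≡w = sumFin-cong (λ i → cong (if does (i ∈? p) then_else 0ℚ) (v≡w i))

  subsetSum-const : ∀ {n} (p : Subset n) (c : ℚ) → subsetSum p (λ _ → c) ≡ sumFin {Subset.∣ p ∣} (λ _ → c)
  subsetSum-const []            c = refl
  subsetSum-const (inside ∷ p)  c = cong (c +_) (subsetSum-const p c)
  subsetSum-const (outside ∷ p) c = trans (ℚ.+-identityˡ _) (subsetSum-const p c)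

  subsetSum-⊥ : ∀ {n} (v : Fin n → ℚ) → subsetSum Subset.⊥ v ≡ 0ℚ
  subsetSum-⊥ {ℕ.zero}  v = refl
  subsetSum-⊥ {ℕ.suc n} v = trans (ℚ.+-identityˡ _) (subsetSum-⊥ (v ∘ suc))

  subsetSum-⁅⁆ : ∀ {n} (a : Fin n) (v : Fin n → ℚ) → subsetSum ⁅ a ⁆ v ≡ v a
  subsetSum-⁅⁆ zero    v = trans (cong (v zero +_) (subsetSum-⊥ (v ∘ suc))) (ℚ.+-identityʳ _)
  subsetSum-⁅⁆ (suc a) v = trans (ℚ.+-identityˡ _) (subsetSum-⁅⁆ a (v ∘ suc))

  -- Littlewood–Richardson coefficients of Gr(1, ℂⁿ)

  members-shift : ∀ {n} (b : Bool) (p : Subset n) (xs : List (Fin n)) →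
    map (ℕ.suc ∘ toℕ) (filter (_∈? (b ∷ p)) (map suc xs)) ≡ map ℕ.suc (map (ℕ.suc ∘ toℕ) (filter (_∈? p) xs))
  members-shift b p []       = refl
  members-shift b p (x ∷ xs) with does (x ∈? p)
  ... | true  = cong (ℕ.suc (ℕ.suc (toℕ x)) ∷_) (members-shift b p xs)
  ... | false = members-shift b p xs

  tabulate-suc : ∀ n → tabulate {n = n} suc ≡ map suc (allFin n)
  tabulate-suc n = sym (map-tabulate (λ i → i) suc)

  members-outside∷ : ∀ {n} (p : Subset n) → members (outside ∷ p) ≡ map ℕ.suc (members p)
  members-outside∷ {n} p rewrite tabulate-suc n = members-shift outside p (allFin n)

  members-inside∷ : ∀ {n} (p : Subset n) → members (inside ∷ p) ≡ 1 ∷ map ℕ.suc (members p)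
  members-inside∷ {n} p rewrite tabulate-suc n = cong (1 ∷_) (members-shift inside p (allFin n))

  members-⊥ : ∀ n → members (Subset.⊥ {n}) ≡ []
  members-⊥ ℕ.zero    = refl
  members-⊥ (ℕ.suc n) = trans (members-outside∷ Subset.⊥) (cong (map ℕ.suc) (members-⊥ n))

  members-⁅⁆ : ∀ {n} (a : Fin n) → members ⁅ a ⁆ ≡ [ ℕ.suc (toℕ a) ]
  members-⁅⁆ {ℕ.suc n} zero    = trans (members-inside∷ Subset.⊥) (cong (λ ms → 1 ∷ map ℕ.suc ms) (members-⊥ n))
  members-⁅⁆ {ℕ.suc n} (suc a) = trans (members-outside∷ ⁅ a ⁆) (cong (map ℕ.suc) (members-⁅⁆ a))

  τ-⁅⁆ : ∀ {n} (a : Fin n) → τ ⁅ a ⁆ ≡ [ toℕ a ]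
  τ-⁅⁆ a rewrite members-⁅⁆ a = refl

  wincr-1 : ∀ m → wincr 1 m 0 ≡ [ replicate m 0 ]
  wincr-1 ℕ.zero    = refl
  wincr-1 (ℕ.suc m) rewrite wincr-1 m = refl

  length-filter-≟0-replicate : ∀ m → length (filter (ℕ._≟ 0) (replicate m 0 ++ [])) ≡ m
  length-filter-≟0-replicate ℕ.zero    = refl
  length-filter-≟0-replicate (ℕ.suc m) = cong ℕ.suc (length-filter-≟0-replicate m)

  schur-1-row : ∀ m → schur 1 [ m ] ≡ [ (ℤ.+ 1 , [ m ]) ]
  schur-1-row m rewrite wincr-1 m | length-filter-≟0-replicate m = refl

  schur-1-rows : ∀ ms → foldr (λ μ acc → schur 1 μ *ᴾ acc) (onePoly 1) (map [_] ms) ≡ [ (ℤ.+ 1 , [ sum ms ]) ]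
  schur-1-rows []       = refl
  schur-1-rows (m ∷ ms) rewrite schur-1-rows ms | schur-1-row m = refl

  lrCoeff-1 : ∀ ms → lrCoeff 1 (map [_] ms) [ sum ms ] ≡ ℤ.+ 1
  lrCoeff-1 ms rewrite schur-1-rows ms | ℕ.+-identityʳ (sum ms)
    | dec-true (≡-dec ℕ._≟_ [ sum ms ] [ sum ms ]) refl = refl

  cLR-1-⁅⁆ : ∀ {r k} (a : Fin k → Fin r) (l : Fin r) → sum (tabulate (toℕ ∘ a)) ≡ toℕ l →
    cLR 1 (λ j → ⁅ a j ⁆) ⁅ l ⁆ ≡ ℤ.+ 1
  cLR-1-⁅⁆ {k = k} a l Σa≡l = begin
    lrCoeff 1 (map (λ j → τ ⁅ a j ⁆) (allFin k)) (τ ⁅ l ⁆)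
      ≡⟨ cong₂ (lrCoeff 1) τs≡ (τ-⁅⁆ l) ⟩
    lrCoeff 1 (map [_] (tabulate (toℕ ∘ a))) [ toℕ l ]
      ≡⟨ cong (λ t → lrCoeff 1 (map [_] (tabulate (toℕ ∘ a))) [ t ]) (sym Σa≡l) ⟩
    lrCoeff 1 (map [_] (tabulate (toℕ ∘ a))) [ sum (tabulate (toℕ ∘ a)) ]
      ≡⟨ lrCoeff-1 (tabulate (toℕ ∘ a)) ⟩
    ℤ.+ 1 ∎
    where
    open ≡-Reasoning
    τs≡ : map (λ j → τ ⁅ a j ⁆) (allFin k) ≡ map [_] (tabulate (toℕ ∘ a))
    τs≡ = trans (map-tabulate (λ j → j) (λ j → τ ⁅ a j ⁆))
                (trans (tabulate-cong (τ-⁅⁆ ∘ a)) (sym (map-tabulate (toℕ ∘ a) [_])))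

  module _ {r s : ℕ} {x : Pt (ℕ.suc r) s} where

    EqLR⇒lam-nonneg : EqLR (ℕ.suc r) s x → ∀ j i → 0ℚ ≤ lam x j i
    EqLR⇒lam-nonneg (lam-decr , _ , lam-last≥0 , _) j i =
      ℚ.≤-trans (lam-last≥0 j (fromℕ r) (toℕ-fromℕ r))
                (lam-decr j i (fromℕ r) (subst (toℕ i ℕ.≤_) (sym (toℕ-fromℕ r)) (toℕ≤pred[n] i)))

    EqLR⇒nu≤nu₀ : EqLR (ℕ.suc r) s x → ∀ i → nu x i ≤ nu x zero
    EqLR⇒nu≤nu₀ (_ , nu-decr , _) i = nu-decr zero i z≤n

    EqLR⇒lam≤lam₀ : EqLR (ℕ.suc r) s x → ∀ j i → lam x j i ≤ lam x j zero
    EqLR⇒lam≤lam₀ (lam-decr , _) j i = lam-decr j zero i z≤n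

    EqLR⇒lam⊆nu : EqLR (ℕ.suc r) s x → ∀ j i → lam x j i ≤ nu x i
    EqLR⇒lam⊆nu (_ , _ , _ , lam⊆nu , _) = lam⊆nu

    EqLR⇒∣nu∣≤Σ∣lam∣ : EqLR (ℕ.suc r) s x → ∣ nu x ∣ᵥ ≤ sumFin (λ j → ∣ lam x j ∣ᵥ)
    EqLR⇒∣nu∣≤Σ∣lam∣ (_ , _ , _ , _ , size , _) = size

  record IsRayCombination {r s : ℕ} (x : Pt r s) (f : Fin (s ∸ 1) → ℚ) : Set where
    field
      coeff≥0 : ∀ j → 0ℚ ≤ f j
      lam≡    : ∀ j i → lam x j i ≡ f j
      nu≡     : ∀ i → nu x i ≡ sumFin f

  rayCombination : ∀ {r s} → (Fin (s ∸ 1) → ℚ) → Pt r s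
  rayCombination f = pt (λ j _ → f j) (λ _ → sumFin f)

  rayCombination-isRayCombination : ∀ {r s} {f : Fin (s ∸ 1) → ℚ} → (∀ j → 0ℚ ≤ f j) →
    IsRayCombination {r} {s} (rayCombination f) f
  rayCombination-isRayCombination f≥0 = record { coeff≥0 = f≥0 ; lam≡ = λ _ _ → refl ; nu≡ = λ _ → refl }

  IsRayCombination-resp-≈ : ∀ {r s} {x y : Pt r s} {f} → y ≈ₚ x → IsRayCombination x f → IsRayCombination y f
  IsRayCombination-resp-≈ (lam-y≡ , nu-y≡) comb = record
    { coeff≥0 = coeff≥0
    ; lam≡    = λ j i → trans (lam-y≡ j i) (lam≡ j i)
    ; nu≡     = λ i → trans (nu-y≡ i) (nu≡ i)
    }
    where open IsRayCombination comb

  ·xRay-isRayCombination : ∀ {r s} {c : ℚ} (j : Fin (s ∸ 1)) → 0ℚ ≤ c →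
    IsRayCombination {r} {s} (c ·ₚ xRay j) (λ j′ → c * δ j j′)
  ·xRay-isRayCombination {r} {s} {c} j c≥0 = record
    { coeff≥0 = c*δ≥0
    ; lam≡    = λ _ _ → refl
    ; nu≡     = λ _ → trans (ℚ.*-identityʳ c) (sym (sumFin-*δ c j))
    }
    where
    c*δ≥0 : ∀ j′ → 0ℚ ≤ c * δ j j′
    c*δ≥0 j′ with does (j ≟ j′)
    ... | true  = subst (0ℚ ≤_) (sym (ℚ.*-identityʳ c)) c≥0
    ... | false = ℚ.≤-reflexive (sym (ℚ.*-zeroʳ c))

  module _ {r s : ℕ} {x : Pt r s} {f : Fin (s ∸ 1) → ℚ} (comb : IsRayCombination x f) where
    open IsRayCombination comb

    IsRayCombination⇒size≡ : sumFin (λ j → ∣ lam x j ∣ᵥ) ≡ ∣ nu x ∣ᵥ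
    IsRayCombination⇒size≡ = begin
      sumFin (λ j → sumFin (lam x j))       ≡⟨ sumFin-cong (λ j → sumFin-cong (lam≡ j)) ⟩
      sumFin (λ j → sumFin {r} (λ _ → f j)) ≡⟨ sumFin-swap (λ j (_ : Fin r) → f j) ⟩
      sumFin {r} (λ _ → sumFin f)           ≡⟨ sumFin-cong (sym ∘ nu≡) ⟩
      sumFin (nu x)                          ∎
      where open ≡-Reasoning

    IsRayCombination⇒horn≡ : ∀ (h : HornData r s) → hornLHS h x ≡ hornRHS h x
    IsRayCombination⇒horn≡ h = begin
      sumFin (λ j → subsetSum (J j) (lam x j))       ≡⟨ sumFin-cong (λ j → subsetSum-cong (J j) (lam≡ j)) ⟩
      sumFin (λ j → subsetSum (J j) (λ _ → f j))     ≡⟨ sumFin-cong (λ j → subsetSum-const-card (J j) (J-card j)) ⟩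
      sumFin (λ j → sumFin {e} (λ _ → f j))          ≡⟨ sumFin-swap (λ j (_ : Fin e) → f j) ⟩
      sumFin {e} (λ _ → sumFin f)                    ≡⟨ sym (subsetSum-const-card L L-card) ⟩
      subsetSum L (λ _ → sumFin f)                   ≡⟨ subsetSum-cong L (sym ∘ nu≡) ⟩
      subsetSum L (nu x)                             ∎
      where
      open ≡-Reasoning
      open HornData h
      subsetSum-const-card : ∀ p {c} → Subset.∣ p ∣ ≡ e → subsetSum p (λ _ → c) ≡ sumFin {e} (λ _ → c)
      subsetSum-const-card p {c} refl = subsetSum-const p c

    IsRayCombination⇒OnAllHornFacets : OnAllHornFacets r s x
    IsRayCombination⇒OnAllHornFacets = (λ _ → IsRayCombination⇒size≡) , IsRayCombination⇒horn≡

    IsRayCombination⇒EqLR : EqLR r s x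
    IsRayCombination⇒EqLR =
        (λ j i i′ _ → ℚ.≤-reflexive (trans (lam≡ j i′) (sym (lam≡ j i))))
      , (λ i i′ _ → ℚ.≤-reflexive (trans (nu≡ i′) (sym (nu≡ i))))
      , (λ j i _ → subst (0ℚ ≤_) (sym (lam≡ j i)) (coeff≥0 j))
      , (λ j i → subst₂ _≤_ (sym (lam≡ j i)) (sym (nu≡ i)) (≤-sumFin coeff≥0 j))
      , ℚ.≤-reflexive (sym IsRayCombination⇒size≡)
      , (λ h → ℚ.≤-reflexive (sym (IsRayCombination⇒horn≡ h)))

  -- Extremality of the rays x_j

  ≈ₚ-trans : ∀ {r s} {x y z : Pt r s} → x ≈ₚ y → y ≈ₚ z → x ≈ₚ z
  ≈ₚ-trans (lam-xy , nu-xy) (lam-yz , nu-yz) =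
    (λ j i → trans (lam-xy j i) (lam-yz j i)) , (λ i → trans (nu-xy i) (nu-yz i))

  ≈ₚ-sym-·1 : ∀ {r s} {x y : Pt r s} → y ≈ₚ (1ℚ ·ₚ x) → x ≈ₚ y
  ≈ₚ-sym-·1 {x = x} (lam-y , nu-y) =
    (λ j i → trans (sym (ℚ.*-identityˡ (lam x j i))) (sym (lam-y j i))) ,
    (λ i → trans (sym (ℚ.*-identityˡ (nu x i))) (sym (nu-y i)))

  Indecomposable : ∀ {r s} → (Pt r s → Set) → Pt r s → Set
  Indecomposable {r} {s} C x =
    ∀ (y z : Pt r s) → C y → C z → (y +ₚ z) ≈ₚ x → Σ ℚ (λ c → (0ℚ ≤ c) × (y ≈ₚ (c ·ₚ x)))

  EqLR-summand-of-·xRay : ∀ {r s} {y z : Pt (ℕ.suc r) s} {c : ℚ} (j : Fin (s ∸ 1)) →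
    EqLR (ℕ.suc r) s y → EqLR (ℕ.suc r) s z → (y +ₚ z) ≈ₚ (c ·ₚ xRay j) → y ≈ₚ (nu y zero ·ₚ xRay j)
  EqLR-summand-of-·xRay {y = y} {z} {c} j y∈C z∈C (lam-sum , nu-sum) = lam-y , nu-y
    where
    d = nu y zero

    nu-y-const : ∀ i → nu y i ≡ d
    nu-y-const i = ≤-+-≡⇒≡ˡ (EqLR⇒nu≤nu₀ y∈C i) (EqLR⇒nu≤nu₀ z∈C i) (trans (nu-sum i) (sym (nu-sum zero)))

    lam-y : ∀ j′ i → lam y j′ i ≡ d * δ j j′
    lam-y j′ i with j ≟ j′ | lam-sum j′ i
    ... | yes refl | sum≡c*1 =
      trans (≤-+-≡⇒≡ˡ (EqLR⇒lam⊆nu y∈C j i) (EqLR⇒lam⊆nu z∈C j i) (trans sum≡c*1 (sym (nu-sum i))))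
            (trans (nu-y-const i) (sym (ℚ.*-identityʳ d)))
    ... | no _     | sum≡c*0 =
      trans (sym (≤-+-≡⇒≡ˡ (EqLR⇒lam-nonneg y∈C j′ i) (EqLR⇒lam-nonneg z∈C j′ i)
                            (trans (ℚ.+-identityˡ 0ℚ) (sym (trans sum≡c*0 (ℚ.*-zeroʳ c))))))
            (sym (ℚ.*-zeroʳ d))

    nu-y : ∀ i → nu y i ≡ d * 1ℚ
    nu-y i = trans (nu-y-const i) (sym (ℚ.*-identityʳ d))

  ·xRay-proportional : ∀ {r s} {x y : Pt r s} {c d : ℚ} (j : Fin (s ∸ 1)) .{{_ : ℚ.NonZero c}} →
    y ≈ₚ (d ·ₚ xRay j) → x ≈ₚ (c ·ₚ xRay j) → y ≈ₚ ((d * 1/ c) ·ₚ x)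
  ·xRay-proportional {x = x} {c = c} {d} j (lam-y , nu-y) (lam-x , nu-x) =
    (λ j′ i → trans (lam-y j′ i) (rescale (lam x j′ i) (lam-x j′ i))) ,
    (λ i → trans (nu-y i) (rescale (nu x i) (nu-x i)))
    where
    rescale : ∀ {t} u → u ≡ c * t → d * t ≡ (d * 1/ c) * u
    rescale {t} u u≡ct = begin
      d * t                      ≡⟨ sym (ℚ.*-identityʳ (d * t)) ⟩
      (d * t) * 1ℚ               ≡⟨ cong ((d * t) *_) (sym (ℚ.*-inverseˡ c)) ⟩
      (d * t) * (1/ c * c)
        ≡⟨ solve 4 (λ d t c′ c → (d :* t) :* (c′ :* c) := (d :* c′) :* (c :* t)) refl d t (1/ c) c ⟩
      (d * 1/ c) * (c * t)       ≡⟨ cong ((d * 1/ c) *_) (sym u≡ct) ⟩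
      (d * 1/ c) * u             ∎
      where open ≡-Reasoning

  ·xRay-nonzero : ∀ {r s} {x : Pt (ℕ.suc r) s} {c : ℚ} (j : Fin (s ∸ 1)) → 0ℚ < c →
    x ≈ₚ (c ·ₚ xRay j) → ¬ (x ≈ₚ zeroₚ)
  ·xRay-nonzero {x = x} {c} j c>0 (_ , nu-x) (_ , nu-x≡0) =
    ℚ.<-irrefl (trans (sym (nu-x≡0 zero)) (trans (nu-x zero) (ℚ.*-identityʳ c))) c>0

  ·xRay-indecomposable : ∀ {r s} {x : Pt (ℕ.suc r) s} {c : ℚ} (j : Fin (s ∸ 1)) → 0ℚ < c →
    x ≈ₚ (c ·ₚ xRay j) → Indecomposable (EqLR (ℕ.suc r) s) x
  ·xRay-indecomposable {r} {s} {c = c} j c>0 x≈cxⱼ y z y∈C z∈C y+z≈x =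
    d * 1/ c , d/c≥0 , ·xRay-proportional {s = s} {c = c} {d} j y≈dxⱼ x≈cxⱼ
    where
    instance
      c-pos : Positive c
      c-pos = ℚ.positive c>0
      c≢0 : ℚ.NonZero c
      c≢0 = ℚ.pos⇒nonZero c
    d = nu y zero
    y≈dxⱼ : y ≈ₚ (d ·ₚ xRay j)
    y≈dxⱼ = EqLR-summand-of-·xRay {s = s} {c = c} j y∈C z∈C (≈ₚ-trans {s = s} y+z≈x x≈cxⱼ)
    d≥0 : 0ℚ ≤ d
    d≥0 = ℚ.≤-trans (EqLR⇒lam-nonneg y∈C j zero) (EqLR⇒lam⊆nu y∈C j zero)
    d/c≥0 : 0ℚ ≤ d * 1/ c
    d/c≥0 = subst (_≤ d * 1/ c) (ℚ.*-zeroˡ (1/ c))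
      (ℚ.*-monoʳ-≤-nonNeg (1/ c) {{ℚ.pos⇒nonNeg (1/ c) {{ℚ.1/pos⇒pos c}}}} d≥0)

  -- Horn equations with e = 1

  -- Row a of block j and row 1 of every other block.  With L = {a} the coefficient c is 1:
  -- τ of a singleton is a one-row partition and in H*(Gr(1, ℂⁿ)) = ℤ[σ]/(σⁿ) the degrees add.
  rowsAt : ∀ {k r} → Fin k → Fin (ℕ.suc r) → Fin k → Fin (ℕ.suc r)
  rowsAt j a j′ = if does (j ≟ j′) then a else zero

  rowsAt-diag : ∀ {k r} (j : Fin k) (a : Fin (ℕ.suc r)) → rowsAt j a j ≡ a
  rowsAt-diag j a rewrite dec-true (j ≟ j) refl = refl

  sum-rowsAt : ∀ {k r} (j : Fin k) (a : Fin (ℕ.suc r)) → sum (tabulate (toℕ ∘ rowsAt j a)) ≡ toℕ a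
  sum-rowsAt {ℕ.suc k} zero    a = trans (cong (toℕ a ℕ.+_) (sum-zeros k)) (ℕ.+-identityʳ (toℕ a))
    where
    sum-zeros : ∀ k → sum (tabulate {n = k} (λ _ → 0)) ≡ 0
    sum-zeros ℕ.zero    = refl
    sum-zeros (ℕ.suc k) = sum-zeros k
  sum-rowsAt {ℕ.suc k} (suc j) a = sum-rowsAt j a

  singleBoxHorn : ∀ {r s} → Fin (s ∸ 1) → Fin (ℕ.suc (ℕ.suc r)) → HornData (ℕ.suc (ℕ.suc r)) s
  singleBoxHorn j a = record
    { e      = 1
    ; e≥1    = s≤s z≤n
    ; e<r    = s≤s (s≤s z≤n)
    ; J      = λ j′ → ⁅ rowsAt j a j′ ⁆
    ; L      = ⁅ a ⁆
    ; J-card = λ j′ → ∣⁅x⁆∣≡1 (rowsAt j a j′)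
    ; L-card = ∣⁅x⁆∣≡1 a
    ; c≡1    = cLR-1-⁅⁆ (rowsAt j a) a (sum-rowsAt j a)
    }

  RowEquations : ∀ {r s} → Pt (ℕ.suc r) s → Set
  RowEquations x = ∀ j a → sumFin (λ j′ → lam x j′ (rowsAt j a j′)) ≡ nu x a

  OnAllHornFacets⇒RowEquations : ∀ {r s} {x : Pt (ℕ.suc r) s} → OnAllHornFacets (ℕ.suc r) s x → RowEquations x
  OnAllHornFacets⇒RowEquations {ℕ.zero} {x = x} (size≡ , _) j zero = begin
    sumFin (λ j′ → lam x j′ (rowsAt j zero j′))
      ≡⟨ sumFin-cong (λ j′ → cong (lam x j′) (if-eta (does (j ≟ j′)))) ⟩
    sumFin (λ j′ → lam x j′ zero)               ≡⟨ sumFin-cong (λ j′ → sym (ℚ.+-identityʳ (lam x j′ zero))) ⟩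
    sumFin (λ j′ → ∣ lam x j′ ∣ᵥ)               ≡⟨ size≡ refl ⟩
    nu x zero + 0ℚ                               ≡⟨ ℚ.+-identityʳ (nu x zero) ⟩
    nu x zero                                    ∎
    where open ≡-Reasoning
  OnAllHornFacets⇒RowEquations {ℕ.suc r} {x = x} (_ , horn≡) j a = begin
    sumFin (λ j′ → lam x j′ (rowsAt j a j′))
      ≡⟨ sumFin-cong (λ j′ → sym (subsetSum-⁅⁆ (rowsAt j a j′) (lam x j′))) ⟩
    sumFin (λ j′ → subsetSum ⁅ rowsAt j a j′ ⁆ (lam x j′))  ≡⟨ horn≡ (singleBoxHorn j a) ⟩
    subsetSum ⁅ a ⁆ (nu x)                                   ≡⟨ subsetSum-⁅⁆ a (nu x) ⟩
    nu x a                                                    ∎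
    where open ≡-Reasoning

  module _ {r m : ℕ} {x : Pt (ℕ.suc r) (3 ℕ.+ m)} (x∈C : EqLR (ℕ.suc r) (3 ℕ.+ m) x) (rows≡ : RowEquations x) where

    private
      colSum : Fin (ℕ.suc r) → ℚ
      colSum a = sumFin (λ j → lam x j a)

      -- The row equations of blocks 1 and 2 at row a, minus the one at row 1; this needs s ≥ 3.
      colSum+nu₀≤nu+nu : ∀ a → colSum a + nu x zero ≤ nu x a + nu x a
      colSum+nu₀≤nu+nu a = begin
        colSum a + nu x zero
          ≤⟨ ℚ.+-monoˡ-≤ (nu x zero) (ℚ.+-monoʳ-≤ λ₀ₐ (ℚ.+-monoʳ-≤ λ₁ₐ
               (sumFin-mono (λ j → EqLR⇒lam≤lam₀ x∈C (suc (suc j)) a)))) ⟩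
        (λ₀ₐ + (λ₁ₐ + R)) + nu x zero
          ≡⟨ cong ((λ₀ₐ + (λ₁ₐ + R)) +_) (sym (rows≡ zero zero)) ⟩
        (λ₀ₐ + (λ₁ₐ + R)) + (λ₀₀ + (λ₁₀ + R))
          ≡⟨ solve 5 (λ a b c d e → (a :+ (b :+ e)) :+ (c :+ (d :+ e)) := (a :+ (d :+ e)) :+ (c :+ (b :+ e)))
                     refl λ₀ₐ λ₁ₐ λ₀₀ λ₁₀ R ⟩
        (λ₀ₐ + (λ₁₀ + R)) + (λ₀₀ + (λ₁ₐ + R))
          ≡⟨ cong₂ _+_ (rows≡ zero a) (rows≡ (suc zero) a) ⟩
        nu x a + nu x a ∎
        where
        open ℚ.≤-Reasoning
        λ₀ₐ = lam x zero a
        λ₁ₐ = lam x (suc zero) a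
        λ₀₀ = lam x zero zero
        λ₁₀ = lam x (suc zero) zero
        R = sumFin (λ j → lam x (suc (suc j)) zero)

      colSum≤nu : ∀ a → colSum a ≤ nu x a
      colSum≤nu a = +-cancelʳ-≤ (nu x zero)
        (ℚ.≤-trans (colSum+nu₀≤nu+nu a) (ℚ.+-monoʳ-≤ (nu x a) (EqLR⇒nu≤nu₀ x∈C a)))

      colSum≡nu : ∀ a → colSum a ≡ nu x a
      colSum≡nu = sumFin-mono-≥⇒≡ colSum≤nu
        (subst (∣ nu x ∣ᵥ ≤_) (sumFin-swap (lam x)) (EqLR⇒∣nu∣≤Σ∣lam∣ x∈C))

    RowEquations⇒nu-const : ∀ a → nu x a ≡ nu x zero
    RowEquations⇒nu-const a = ℚ.≤-antisym (EqLR⇒nu≤nu₀ x∈C a)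
      (+-cancelˡ-≤ (nu x a) (subst (λ t → t + nu x zero ≤ nu x a + nu x a) (colSum≡nu a) (colSum+nu₀≤nu+nu a)))

    RowEquations⇒lam-const : ∀ j a → lam x j a ≡ lam x j zero
    RowEquations⇒lam-const j a =
      trans (sym (cong (lam x j) (rowsAt-diag j a)))
            (sumFin-mono-≡⇒≡ (λ j′ → EqLR⇒lam≤lam₀ x∈C j′ (rowsAt j a j′))
                             (trans (rows≡ j a) (trans (RowEquations⇒nu-const a) (sym (rows≡ zero zero)))) j)

    RowEquations⇒IsRayCombination : IsRayCombination x (λ j → lam x j zero)
    RowEquations⇒IsRayCombination = record
      { coeff≥0 = λ j → EqLR⇒lam-nonneg x∈C j zero
      ; lam≡    = RowEquations⇒lam-const
      ; nu≡     = λ i → trans (RowEquations⇒nu-const i) (sym (rows≡ zero zero))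
      }

  IsRayCombination⇒positive-coeff : ∀ {r s} {x : Pt r s} {f : Fin (s ∸ 1) → ℚ} →
    IsRayCombination x f → ¬ (x ≈ₚ zeroₚ) → Σ (Fin (s ∸ 1)) (λ j → 0ℚ < f j)
  IsRayCombination⇒positive-coeff {s = s} {x} {f} comb x≢0 with any? (λ j → 0ℚ ℚ.<? f j)
  ... | yes f>0 = f>0
  ... | no  f≯0 = ⊥-elim (x≢0 ((λ j i → trans (lam≡ j i) (f≡0 j)) , (λ i → trans (nu≡ i) Σf≡0)))
    where
    open IsRayCombination comb
    f≡0 : ∀ j → f j ≡ 0ℚ
    f≡0 j = ℚ.≤-antisym (ℚ.≮⇒≥ (λ fⱼ>0 → f≯0 (j , fⱼ>0))) (coeff≥0 j)
    Σf≡0 : sumFin f ≡ 0ℚ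
    Σf≡0 = trans (sumFin-cong f≡0) (sumFin-zero (s ∸ 1))

  Indecomposable⇒·xRay : ∀ {r s} {x : Pt (ℕ.suc r) s} {f : Fin (s ∸ 1) → ℚ} (j : Fin (s ∸ 1)) →
    Indecomposable (EqLR (ℕ.suc r) s) x → IsRayCombination x f → 0ℚ < f j → x ≈ₚ (f j ·ₚ xRay j)
  Indecomposable⇒·xRay {r} {s} {x} {f} j x-indec comb fⱼ>0 =
    ≈ₚ-sym-·1 {s = s} (subst (λ c → y ≈ₚ (c ·ₚ x)) c≡1 y≈cx)
    where
    open IsRayCombination comb
    instance
      fⱼ-pos : Positive (f j)
      fⱼ-pos = ℚ.positive fⱼ>0

    fᶜ : Fin (s ∸ 1) → ℚ
    fᶜ j′ = if does (j ≟ j′) then 0ℚ else f j′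

    fᶜ≥0 : ∀ j′ → 0ℚ ≤ fᶜ j′
    fᶜ≥0 j′ with does (j ≟ j′)
    ... | true  = ℚ.≤-refl
    ... | false = coeff≥0 j′

    y z : Pt (ℕ.suc r) s
    y = f j ·ₚ xRay j
    z = rayCombination fᶜ

    split : ∀ j′ → f j * δ j j′ + fᶜ j′ ≡ f j′
    split j′ with j ≟ j′
    ... | yes refl = trans (ℚ.+-identityʳ (f j * 1ℚ)) (ℚ.*-identityʳ (f j))
    ... | no _     = trans (cong (_+ f j′) (ℚ.*-zeroʳ (f j))) (ℚ.+-identityˡ (f j′))

    y+z≈x : (y +ₚ z) ≈ₚ x
    y+z≈x = (λ j′ i → trans (split j′) (sym (lam≡ j′ i)))
          , (λ i → begin
               f j * 1ℚ + sumFin fᶜ                     ≡⟨ cong (_+ sumFin fᶜ) (ℚ.*-identityʳ (f j)) ⟩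
               f j + sumFin fᶜ                          ≡⟨ cong (_+ sumFin fᶜ) (sym (sumFin-*δ (f j) j)) ⟩
               sumFin (λ j′ → f j * δ j j′) + sumFin fᶜ ≡⟨ sym (sumFin-+ (λ j′ → f j * δ j j′) fᶜ) ⟩
               sumFin (λ j′ → f j * δ j j′ + fᶜ j′)     ≡⟨ sumFin-cong split ⟩
               sumFin f                                 ≡⟨ sym (nu≡ i) ⟩
               nu x i                                   ∎)
      where open ≡-Reasoning

    decomposition = x-indec y z (IsRayCombination⇒EqLR (·xRay-isRayCombination j (ℚ.<⇒≤ fⱼ>0)))
                               (IsRayCombination⇒EqLR (rayCombination-isRayCombination fᶜ≥0)) y+z≈x
    c = proj₁ decomposition
    y≈cx : y ≈ₚ (c ·ₚ x)
    y≈cx = proj₂ (proj₂ decomposition)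

    c≡1 : c ≡ 1ℚ
    c≡1 = *-cancelʳ-≡-pos (f j) (begin
      c * f j          ≡⟨ cong (c *_) (sym (lam≡ j zero)) ⟩
      c * lam x j zero ≡⟨ sym (proj₁ y≈cx j zero) ⟩
      f j * δ j j      ≡⟨ cong (f j *_) (δ-diag j) ⟩
      f j * 1ℚ         ≡⟨ ℚ.*-comm (f j) 1ℚ ⟩
      1ℚ * f j         ∎)
      where open ≡-Reasoning

open import Data.Nat using (_≤_)

corollary5p5 : (r s : ℕ) → 1 ≤ r → 3 ≤ s → (x : Pt r s) →
    (IsExtremalRay (EqLR r s) x × OnAllHornFacets r s x)
      ⇔ Σ (Fin (s Data.Nat.∸ 1)) (λ j → Σ ℚ (λ c → (0ℚ < c) × (x ≈ₚ (c ·ₚ xRay j))))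
corollary5p5 (ℕ.suc r) (ℕ.suc (ℕ.suc (ℕ.suc m))) (s≤s _) (s≤s (s≤s (s≤s _))) x =
  mk⇔ extremal⇒ray ray⇒extremal
  where
  extremal⇒ray : IsExtremalRay (EqLR _ _) x × OnAllHornFacets _ _ x →
    Σ (Fin (ℕ.suc (ℕ.suc m))) (λ j → Σ ℚ (λ c → (0ℚ < c) × (x ≈ₚ (c ·ₚ xRay j))))
  extremal⇒ray ((x∈C , x≢0 , x-indec) , facets) = j , _ , fⱼ>0 , Indecomposable⇒·xRay j x-indec comb fⱼ>0
    where
    comb : IsRayCombination x (λ j → lam x j zero)
    comb = RowEquations⇒IsRayCombination x∈C (OnAllHornFacets⇒RowEquations {x = x} facets)
    j = proj₁ (IsRayCombination⇒positive-coeff comb x≢0)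
    fⱼ>0 = proj₂ (IsRayCombination⇒positive-coeff comb x≢0)

  ray⇒extremal : Σ (Fin (ℕ.suc (ℕ.suc m))) (λ j → Σ ℚ (λ c → (0ℚ < c) × (x ≈ₚ (c ·ₚ xRay j)))) →
    IsExtremalRay (EqLR _ _) x × OnAllHornFacets _ _ x
  ray⇒extremal (j , c , c>0 , x≈cxⱼ) =
    (IsRayCombination⇒EqLR comb , ·xRay-nonzero {x = x} j c>0 x≈cxⱼ , ·xRay-indecomposable j c>0 x≈cxⱼ) ,
    IsRayCombination⇒OnAllHornFacets comb
    where
    comb : IsRayCombination x (λ j′ → c * δ j j′)
    comb = IsRayCombination-resp-≈ x≈cxⱼ (·xRay-isRayCombination j (ℚ.<⇒≤ c>0))
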